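{- $\alpha(4)=1$, $\alpha(3) \ge 1/2$, $\beta(4) \ge 1/3$, and $\beta(3) \ge 1/4$.
   Context: For an integer $n\ge 3$, a set $S$ of positive integers is called $n$-free if its elements can be arranged in a sequence $(s_1,s_2,\ldots)$ (a finite sequence if $S$ is finite, a sequence indexed by the positive integers if $S$ is infinite) in which every element of $S$ appears exactly once and there are no indices $i_1<i_2<\cdots<i_n$ such that $s_{i_1},\ldots,s_{i_n}$ is an arithmetic progression (with nonzero common difference). For $S\subseteq\{1,2,3,\ldots\}$ let $A(m)=|S\cap[1,m]|$, and define the upper density $\overline{d}(S)=\limsup_{m\to\infty} A(m)/m$ and lower density $\underline{d}(S)=\liminf_{m\to\infty} A(m)/m$. For $n\ge 3$, $\alpha(n)=\sup\{\overline{d}(S): S \text{ is } n\text{ -free}\}$ and $\beta(n)=\sup\{\underline{d}(S): S \text{ is } n\text{ -free}\}$, the suprema taken over subsets $S$ of the positive integers. -}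

module Defs where

open import Data.Bool using (Bool; true; false; if_then_else_)
open import Data.Nat as ℕ using (ℕ; zero; suc)
open import Data.Integer as ℤ using (ℤ; +_)
open import Data.Rational using (ℚ; 0ℚ; _<_; _-_; _+_; _/_)
open import Data.Fin as Fin using (Fin; toℕ)
open import Data.List using (List; length; lookup)
open import Data.List.Relation.Unary.Unique.Propositional using (Unique)
open import Data.List.Membership.Propositional using (_∈_)
open import Data.Product using (Σ; ∃; _×_; _,_)
open import Function.Definitions using (Injective)
open import Relation.Binary.PropositionalEquality using (_≡_; _≢_)
open import Relation.Nullary using (¬_)

NatSet : Set
NatSet = ℕ → Bool

PositiveSet : NatSet → Set
PositiveSet S = S 0 ≡ false

IsNontrivialAP : (n : ℕ) → (Fin n → ℕ) → Set
IsNontrivialAP n v =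
  Σ ℤ λ a → Σ ℤ λ d → (d ≢ + 0) × (∀ (k : Fin n) → + (v k) ≡ a ℤ.+ (+ toℕ k) ℤ.* d)

NoAPSeq : ℕ → (ℕ → ℕ) → Set
NoAPSeq n s = ∀ (idx : Fin n → ℕ) →
  (∀ (j k : Fin n) → j Fin.< k → idx j ℕ.< idx k) →
  ¬ IsNontrivialAP n (λ k → s (idx k))

NoAPList : ℕ → List ℕ → Set
NoAPList n xs = ∀ (idx : Fin n → Fin (length xs)) →
  (∀ (j k : Fin n) → j Fin.< k → idx j Fin.< idx k) →
  ¬ IsNontrivialAP n (λ k → lookup xs (idx k))

Free : ℕ → NatSet → Set
Free n S =
  (Σ (List ℕ) λ xs → Unique xs × (∀ x → (S x ≡ true → x ∈ xs) × (x ∈ xs → S x ≡ true))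
                   × NoAPList n xs)
  ⊎' (Σ (ℕ → ℕ) λ s → Injective _≡_ _≡_ s
                   × (∀ x → (S x ≡ true → ∃ λ i → s i ≡ x) × (∃ (λ i → s i ≡ x) → S x ≡ true))
                   × NoAPSeq n s)
  where
  open import Data.Sum using () renaming (_⊎_ to _⊎'_)

count : NatSet → ℕ → ℕ
count S zero = 0
count S (suc m) = count S m ℕ.+ (if S (suc m) then 1 else 0)

-- A(m)/m at m = suc k (m ≥ 1)
ratio : NatSet → ℕ → ℚ
ratio S k = + count S (suc k) / suc k

UpperDensityAtLeast : NatSet → ℚ → Set
UpperDensityAtLeast S c = ∀ ε → 0ℚ < ε → ∀ M → ∃ λ k → (M ℕ.≤ k) × (c - ε < ratio S k)

UpperDensityAtMost : NatSet → ℚ → Set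
UpperDensityAtMost S c = ∀ ε → 0ℚ < ε → ∃ λ M → ∀ k → M ℕ.≤ k → ratio S k < c + ε

LowerDensityAtLeast : NatSet → ℚ → Set
LowerDensityAtLeast S c = ∀ ε → 0ℚ < ε → ∃ λ M → ∀ k → M ℕ.≤ k → c - ε < ratio S k

-- α(n) ≥ c : sup over n-free S ⊆ ℤ⁺ of upper density is ≥ c
AlphaAtLeast : ℕ → ℚ → Set
AlphaAtLeast n c = ∀ ε → 0ℚ < ε →
  Σ NatSet λ S → PositiveSet S × Free n S × UpperDensityAtLeast S (c - ε)

AlphaAtMost : ℕ → ℚ → Set
AlphaAtMost n c = ∀ S → PositiveSet S → Free n S → UpperDensityAtMost S c

-- β(n) ≥ c : sup over n-free S ⊆ ℤ⁺ of lower density is ≥ c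
BetaAtLeast : ℕ → ℚ → Set
BetaAtLeast n c = ∀ ε → 0ℚ < ε →
  Σ NatSet λ S → PositiveSet S × Free n S × LowerDensityAtLeast S (c - ε)

module Submission where

open import Defs
open import Data.Product using (_×_)
open import Data.Integer using (+_)
open import Data.Rational using (1ℚ; _/_)

-- S is a union of blocks (A j, A j + n j] with 2 (A j + n j) ≤ A (j + 1), enumerated block
-- after block, each block in an order without 3-term progressions (evens first, then odds,
-- both recursively).  In a progression x, y, z with y, z in different blocks, 2 y < z ≤ x + z,
-- so the last three terms of a 4-term progression lie in one block, which is impossible.
-- If moreover A j + n j + n (j + 1) ≤ A (j + 1), then also x + z < 2 y whenever x lies in an
-- earlier block than y and z, so S is 3-free.  The blocks (2·3^j, 3^(j+1)] give a 3-free set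
-- with upper density 1/2 and lower density 1/4, the blocks (2·4^j, 4^(j+1)] a 4-free set of
-- lower density 1/3, and ((2t+2)^j, (t+1)(2t+2)^j] 4-free sets of upper density t/(t+1).

module Density where

  open import Data.Bool using (true; false)
  open import Data.Nat as ℕ using (ℕ; zero; suc)
  import Data.Nat.Properties as ℕ
  open import Data.Nat.Tactic.RingSolver using (solve-∀)
  import Data.Integer as ℤ
  import Data.Integer.Properties as ℤ
  open import Data.Product using (_,_; ∃)
  open import Data.Rational as ℚ using (mkℚ; 0ℚ; _≤_; _<_; _+_; _-_; -_; ↧ₙ_; fromℚᵘ; toℚᵘ)
  open import Data.Rational.Properties
  open import Data.Rational.Unnormalised as ℚᵘ using (mkℚᵘ; *≤*)
  import Data.Rational.Unnormalised.Properties as ℚᵘ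
  open import Relation.Binary.PropositionalEquality

  fromℚᵘ-mono-≤ : ∀ {p q} → p ℚᵘ.≤ q → fromℚᵘ p ≤ fromℚᵘ q
  fromℚᵘ-mono-≤ {p} {q} p≤q = toℚᵘ-cancel-≤
    (ℚᵘ.≤-respˡ-≃ (ℚᵘ.≃-sym (toℚᵘ-fromℚᵘ p))
      (ℚᵘ.≤-respʳ-≃ (ℚᵘ.≃-sym (toℚᵘ-fromℚᵘ q)) p≤q))

  fromℚᵘ-homo-+ : ∀ p q → fromℚᵘ (p ℚᵘ.+ q) ≡ fromℚᵘ p + fromℚᵘ q
  fromℚᵘ-homo-+ p q = trans (fromℚᵘ-cong p+q≃) (fromℚᵘ-toℚᵘ (fromℚᵘ p + fromℚᵘ q))
    where
    p+q≃ : p ℚᵘ.+ q ℚᵘ.≃ toℚᵘ (fromℚᵘ p + fromℚᵘ q)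
    p+q≃ = ℚᵘ.≃-sym (ℚᵘ.≃-trans (toℚᵘ-homo-+ (fromℚᵘ p) (fromℚᵘ q))
                                 (ℚᵘ.+-cong (toℚᵘ-fromℚᵘ p) (toℚᵘ-fromℚᵘ q)))

  /-mono-≤ : ∀ a b c d → a ℕ.* suc d ℕ.≤ c ℕ.* suc b → + a / suc b ≤ + c / suc d
  /-mono-≤ a b c d ad≤cb = fromℚᵘ-mono-≤ {mkℚᵘ (+ a) b} {mkℚᵘ (+ c) d}
    (*≤* (subst₂ ℤ._≤_ (ℤ.pos-* a (suc d)) (ℤ.pos-* c (suc b)) (ℤ.+≤+ ad≤cb)))

  /-+-/ : ∀ a b c d → + a / suc b + + c / suc d ≡ + (a ℕ.* suc d ℕ.+ c ℕ.* suc b) / (suc b ℕ.* suc d)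
  /-+-/ a b c d = trans (sym (fromℚᵘ-homo-+ (mkℚᵘ (+ a) b) (mkℚᵘ (+ c) d)))
    (cong (λ i → i / (suc b ℕ.* suc d)) (sym (trans (ℤ.pos-+ (a ℕ.* suc d) (c ℕ.* suc b))
                                                 (cong₂ ℤ._+_ (ℤ.pos-* a (suc d)) (ℤ.pos-* c (suc b))))))

  1/suc≤ : ∀ ε N → 0ℚ < ε → ↧ₙ ε ℕ.≤ suc N → + 1 / suc N ≤ ε
  1/suc≤ ε@(mkℚ ℤ.+[1+ p ] d _) N _ d<N = subst (+ 1 / suc N ≤_) (fromℚᵘ-toℚᵘ ε)
    (/-mono-≤ 1 N (suc p) d (ℕ.≤-trans (ℕ.≤-reflexive (ℕ.*-identityˡ (suc d)))
                                       (ℕ.≤-trans d<N (ℕ.m≤n*m (suc N) (suc p)))))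
  1/suc≤ (mkℚ (+ 0)      _ _) _ (ℚ.*<* (ℤ.+<+ ())) _
  1/suc≤ (mkℚ ℤ.-[1+ _ ] _ _) _ (ℚ.*<* ()) _

  p-q<p : ∀ p {q} → 0ℚ < q → p - q < p
  p-q<p p {q} 0<q = subst (p - q <_) (+-identityʳ p) (+-monoʳ-< p (neg-antimono-< 0<q))

  c-ε≤r : ∀ {c r η ε} → c ≤ r + η → η ≤ ε → c - ε ≤ r
  c-ε≤r {c} {r} {η} {ε} c≤r+η η≤ε = begin
    c - ε         ≤⟨ +-monoʳ-≤ c (neg-antimono-≤ η≤ε) ⟩
    c - η         ≤⟨ +-monoˡ-≤ (- η) c≤r+η ⟩
    r + η - η     ≡⟨ +-assoc r η (- η) ⟩
    r + (η - η)   ≡⟨ cong (_+_ r) (+-inverseʳ η) ⟩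
    r + 0ℚ        ≡⟨ +-identityʳ r ⟩
    r             ∎
    where open ≤-Reasoning

  upperDensity-frequent : ∀ S a b → (∀ M → ∃ λ m → M ℕ.< m × a ℕ.* m ℕ.≤ count S m ℕ.* suc b) →
                          UpperDensityAtLeast S (+ a / suc b)
  upperDensity-frequent S a b often ε 0<ε M with often M
  ... | suc k , M<m , am≤ =
    k , ℕ.s≤s⁻¹ M<m , <-≤-trans (p-q<p _ 0<ε) (/-mono-≤ a b (count S (suc k)) k am≤)

  upperDensity-mono : ∀ {S c c′} → c′ ≤ c → UpperDensityAtLeast S c → UpperDensityAtLeast S c′
  upperDensity-mono c′≤c dense ε 0<ε M with dense ε 0<ε M
  ... | k , M≤k , c-ε<r = k , M≤k , ≤-<-trans (+-monoˡ-≤ (- ε) c′≤c) c-ε<r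

  square-bound : ∀ m K c cnt → c ℕ.≤ K → m ℕ.≤ K ℕ.* cnt ℕ.+ c →
                 1 ℕ.* (m ℕ.* m) ℕ.≤ (cnt ℕ.* m ℕ.+ 1 ℕ.* m) ℕ.* K
  square-bound m K c cnt c≤K m≤ = begin
    1 ℕ.* (m ℕ.* m)                ≡⟨ ℕ.*-identityˡ (m ℕ.* m) ⟩
    m ℕ.* m                        ≤⟨ ℕ.*-monoˡ-≤ m (ℕ.≤-trans m≤ (ℕ.+-monoʳ-≤ _ c≤K)) ⟩
    (K ℕ.* cnt ℕ.+ K) ℕ.* m        ≡⟨ rearrange m cnt K ⟩
    (cnt ℕ.* m ℕ.+ 1 ℕ.* m) ℕ.* K  ∎
    where
    open ℕ.≤-Reasoning
    rearrange : ∀ m cnt K → (K ℕ.* cnt ℕ.+ K) ℕ.* m ≡ (cnt ℕ.* m ℕ.+ 1 ℕ.* m) ℕ.* K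
    rearrange = solve-∀

  1/K≤ratio+1/m : ∀ S K c k → c ℕ.≤ suc K → suc k ℕ.≤ suc K ℕ.* count S (suc k) ℕ.+ c →
                  + 1 / suc K ≤ ratio S k + + 1 / suc k
  1/K≤ratio+1/m S K c k c≤K m≤ = subst (+ 1 / suc K ≤_) (sym (/-+-/ cnt k 1 k))
    (/-mono-≤ 1 K (cnt ℕ.* suc k ℕ.+ 1 ℕ.* suc k) (k ℕ.+ k ℕ.* suc k)
              (square-bound (suc k) (suc K) c cnt c≤K m≤))
    where
    cnt : ℕ
    cnt = count S (suc k)

  lowerDensity-linear : ∀ S K c → c ℕ.≤ suc K → (∀ m → m ℕ.≤ suc K ℕ.* count S m ℕ.+ c) →
                        ∀ ε → 0ℚ < ε → LowerDensityAtLeast S (+ 1 / suc K - ε)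
  lowerDensity-linear S K c c≤K bound ε 0<ε ε′ 0<ε′ = ↧ₙ ε′ , λ k M≤k →
    <-≤-trans (+-monoˡ-< (- ε′) (p-q<p (+ 1 / suc K) 0<ε))
              (c-ε≤r (1/K≤ratio+1/m S K c k c≤K (bound (suc k)))
                     (1/suc≤ ε′ k 0<ε′ (ℕ.m≤n⇒m≤1+n M≤k)))

  upperDensity-linear : ∀ S K c → c ℕ.≤ suc K →
                        (∀ M → ∃ λ m → M ℕ.< m × m ℕ.≤ suc K ℕ.* count S m ℕ.+ c) →
                        ∀ ε → 0ℚ < ε → UpperDensityAtLeast S (+ 1 / suc K - ε)
  upperDensity-linear S K c c≤K often ε 0<ε ε′ 0<ε′ M with often (M ℕ.+ ↧ₙ ε′)
  ... | suc k , M+N≤k , m≤ = k , ℕ.m+n≤o⇒m≤o M (ℕ.s≤s⁻¹ M+N≤k) ,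
    <-≤-trans (+-monoˡ-< (- ε′) (p-q<p (+ 1 / suc K) 0<ε))
              (c-ε≤r (1/K≤ratio+1/m S K c k c≤K m≤)
                     (1/suc≤ ε′ k 0<ε′ (ℕ.m≤n⇒m≤1+n (ℕ.m+n≤o⇒n≤o M (ℕ.s≤s⁻¹ M+N≤k)))))

  1-ε≤t/1+t : ∀ ε → 0ℚ < ε → 1ℚ - ε ≤ + ↧ₙ ε / suc (↧ₙ ε)
  1-ε≤t/1+t ε 0<ε = c-ε≤r 1≤t/1+t+1/1+t (1/suc≤ ε t 0<ε (ℕ.n≤1+n t))
    where
    t : ℕ
    t = ↧ₙ ε
    1≤t/1+t+1/1+t : 1ℚ ≤ + t / suc t + + 1 / suc t
    1≤t/1+t+1/1+t = subst (1ℚ ≤_) (sym (/-+-/ t t 1 t))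
      (/-mono-≤ 1 0 (t ℕ.* suc t ℕ.+ 1 ℕ.* suc t) (t ℕ.+ t ℕ.* suc t) (ℕ.≤-reflexive (sum-of-parts t)))
      where
      sum-of-parts : ∀ t → 1 ℕ.* (suc t ℕ.* suc t) ≡ (t ℕ.* suc t ℕ.+ 1 ℕ.* suc t) ℕ.* 1
      sum-of-parts = solve-∀

  count≤ : ∀ S m → count S m ℕ.≤ m
  count≤ S zero    = ℕ.z≤n
  count≤ S (suc m) with S (suc m)
  ... | true  = ℕ.≤-trans (ℕ.≤-reflexive (ℕ.+-comm (count S m) 1)) (ℕ.s≤s (count≤ S m))
  ... | false = ℕ.≤-trans (ℕ.≤-reflexive (ℕ.+-identityʳ (count S m))) (ℕ.m≤n⇒m≤1+n (count≤ S m))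

  upperDensity≤1 : ∀ S → UpperDensityAtMost S 1ℚ
  upperDensity≤1 S ε 0<ε = 0 , λ k _ →
    ≤-<-trans (ratio≤1 k) (subst (_< 1ℚ + ε) (+-identityʳ 1ℚ) (+-monoʳ-< 1ℚ 0<ε))
    where
    ratio≤1 : ∀ k → ratio S k ≤ 1ℚ
    ratio≤1 k = /-mono-≤ (count S (suc k)) k 1 0
      (ℕ.≤-trans (ℕ.≤-reflexive (ℕ.*-identityʳ _))
        (ℕ.≤-trans (count≤ S (suc k)) (ℕ.≤-reflexive (sym (ℕ.*-identityˡ (suc k))))))

open Density

open import Data.Nat as ℕ
  using (ℕ; zero; suc; _+_; _*_; _^_; _∸_; _≤_; _<_; _<?_; _≤?_; _≤′_; ≤′-refl; ≤′-step;
         z≤n; s≤s; z<s; s<s; s<s⁻¹; ⌊_/2⌋; ⌈_/2⌉)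
open import Data.Nat.Properties
open import Data.Nat.Tactic.RingSolver using (solve-∀)
import Data.Integer as ℤ
import Data.Integer.Properties as ℤ
import Data.Integer.Tactic.RingSolver as ℤ-Solver
open import Data.Bool using (true)
open import Data.Fin as Fin using (Fin; toℕ; fromℕ<)
open import Data.Fin.Properties using (any?; toℕ-fromℕ<)
open import Data.Product using (_,_; proj₁; ∃)
open import Data.Product.Relation.Binary.Lex.Strict using (×-Lex; ×-transitive)
open import Data.Sum using (_⊎_; inj₁; inj₂)
open import Function using (_∘_)
open import Function.Definitions using (Injective)
open import Relation.Binary.Definitions using (tri<; tri≈; tri>)
open import Relation.Binary.PropositionalEquality
open import Relation.Nullary using (¬_; Dec; yes; no; does; proof; contradiction)
open import Relation.Nullary.Decidable using (_×-dec_; dec-true; dec-false)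
open import Relation.Nullary.Reflects using (Reflects; invert)
open import Data.Rational using (↧ₙ_)

pattern 0F = Fin.zero
pattern 1F = Fin.suc 0F
pattern 2F = Fin.suc 1F
pattern 3F = Fin.suc 2F

AP₃ : ℕ → ℕ → ℕ → Set
AP₃ x y z = x + z ≡ 2 * y

AP₃-cancelˡ : ∀ r {x y z} → AP₃ (r + x) (r + y) (r + z) → AP₃ x y z
AP₃-cancelˡ r {x} {y} {z} ap = +-cancelˡ-≡ (2 * r) _ _ (begin
  2 * r + (x + z)        ≡⟨ shuffle r x z ⟩
  (r + x) + (r + z)      ≡⟨ ap ⟩
  2 * (r + y)            ≡⟨ *-distribˡ-+ 2 r y ⟩
  2 * r + 2 * y          ∎)
  where
  open ≡-Reasoning
  shuffle : ∀ r x z → 2 * r + (x + z) ≡ (r + x) + (r + z)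
  shuffle = solve-∀

AP₃-cancel-2* : ∀ {x y z} → AP₃ (2 * x) (2 * y) (2 * z) → AP₃ x y z
AP₃-cancel-2* {x} {y} {z} ap =
  *-cancelˡ-≡ (x + z) (2 * y) 2 (trans (*-distribˡ-+ 2 x z) ap)

¬AP₃-even-odd : ∀ x y z → ¬ AP₃ (2 * x) y (1 + 2 * z)
¬AP₃-even-odd x y z ap = even≢odd y (x + z) (begin
  2 * y                  ≡⟨ ap ⟨
  2 * x + (1 + 2 * z)    ≡⟨ +-suc (2 * x) (2 * z) ⟩
  1 + (2 * x + 2 * z)    ≡⟨ cong suc (*-distribˡ-+ 2 x z) ⟨
  1 + 2 * (x + z)        ∎)
  where open ≡-Reasoning

IsNontrivialAP-tail : ∀ {n} v → IsNontrivialAP (suc n) v → IsNontrivialAP n (v ∘ Fin.suc)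
IsNontrivialAP-tail v (a , d , d≢0 , v≡) =
  a ℤ.+ d , d , d≢0 , λ k → trans (v≡ (Fin.suc k)) (shift a d (+ toℕ k))
  where
  shift : ∀ a d k → a ℤ.+ (ℤ.+ 1 ℤ.+ k) ℤ.* d ≡ (a ℤ.+ d) ℤ.+ k ℤ.* d
  shift = ℤ-Solver.solve-∀

IsNontrivialAP⇒AP₃ : ∀ {n} v → IsNontrivialAP (3 + n) v →
                     AP₃ (v 0F) (v 1F) (v 2F)
IsNontrivialAP⇒AP₃ v (a , d , _ , v≡) = ℤ.+-injective (begin
  + (v₀ + v₂)                          ≡⟨ ℤ.pos-+ v₀ v₂ ⟩
  + v₀ ℤ.+ + v₂                        ≡⟨ cong₂ ℤ._+_ (v≡ _) (v≡ _) ⟩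
  a ℤ.+ + 0 ℤ.* d ℤ.+ (a ℤ.+ + 2 ℤ.* d) ≡⟨ middle a d ⟩
  + 2 ℤ.* (a ℤ.+ + 1 ℤ.* d)            ≡⟨ cong (+ 2 ℤ.*_) (v≡ _) ⟨
  + 2 ℤ.* + v₁                         ≡⟨ ℤ.pos-* 2 v₁ ⟨
  + (2 * v₁)                           ∎)
  where
  open ≡-Reasoning
  v₀ v₁ v₂ : ℕ
  v₀ = v 0F
  v₁ = v 1F
  v₂ = v 2F
  middle : ∀ a d → a ℤ.+ + 0 ℤ.* d ℤ.+ (a ℤ.+ + 2 ℤ.* d) ≡ + 2 ℤ.* (a ℤ.+ + 1 ℤ.* d)
  middle = ℤ-Solver.solve-∀

even-or-odd : ∀ v → ∃ λ w → v ≡ 2 * w ⊎ v ≡ 1 + 2 * w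
even-or-odd zero = 0 , inj₁ refl
even-or-odd (suc v) with even-or-odd v
... | w , inj₁ refl = w , inj₂ refl
... | w , inj₂ refl = suc w , inj₁ (sym (*-suc 2 w))

2*<⇒<⌈/2⌉ : ∀ x n → 2 * x < n → x < ⌈ n /2⌉
2*<⇒<⌈/2⌉ zero    (suc n)       _  = z<s
2*<⇒<⌈/2⌉ (suc x) (suc zero)    (s≤s ())
2*<⇒<⌈/2⌉ (suc x) (suc (suc n)) lt =
  s<s (2*<⇒<⌈/2⌉ x n (s<s⁻¹ (s<s⁻¹ (subst (_< suc (suc n)) (*-suc 2 x) lt))))

<⌈/2⌉⇒2*< : ∀ x n → x < ⌈ n /2⌉ → 2 * x < n
<⌈/2⌉⇒2*< zero    (suc n)       _  = z<s
<⌈/2⌉⇒2*< (suc x) (suc zero)    (s≤s ())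
<⌈/2⌉⇒2*< (suc x) (suc (suc n)) lt =
  subst (_< suc (suc n)) (sym (*-suc 2 x)) (s<s (s<s (<⌈/2⌉⇒2*< x n (s<s⁻¹ lt))))

1+2*<⇒<⌊/2⌋ : ∀ x n → 1 + 2 * x < n → x < ⌊ n /2⌋
1+2*<⇒<⌊/2⌋ x (suc n) lt = 2*<⇒<⌈/2⌉ x n (s<s⁻¹ lt)

<⌊/2⌋⇒1+2*< : ∀ x n → x < ⌊ n /2⌋ → 1 + 2 * x < n
<⌊/2⌋⇒1+2*< x (suc n) lt = s<s (<⌈/2⌉⇒2*< x n lt)

∸⌈/2⌉-< : ∀ {o n} → ¬ o < ⌈ n /2⌉ → o < n → o ∸ ⌈ n /2⌉ < ⌊ n /2⌋
∸⌈/2⌉-< {o} {n} o≮ o<n = subst (o ∸ ⌈ n /2⌉ <_) n∸⌈n/2⌉≡⌊n/2⌋ (∸-monoˡ-< o<n (≮⇒≥ o≮))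
  where
  n∸⌈n/2⌉≡⌊n/2⌋ : n ∸ ⌈ n /2⌉ ≡ ⌊ n /2⌋
  n∸⌈n/2⌉≡⌊n/2⌋ =
    trans (cong (_∸ ⌈ n /2⌉) (sym (⌊n/2⌋+⌈n/2⌉≡n n))) (m+n∸n≡m ⌊ n /2⌋ ⌈ n /2⌉)

⌈/2⌉-fuel : ∀ {n f} → n ≤ 2 + f → ⌈ n /2⌉ ≤ 1 + f
⌈/2⌉-fuel {zero}        _  = z≤n
⌈/2⌉-fuel {suc zero}    _  = s≤s z≤n
⌈/2⌉-fuel {suc (suc n)} le = s<s⁻¹ (≤-trans (⌈n/2⌉<n n) le)

⌊/2⌋-fuel : ∀ {n f} → n ≤ 2 + f → ⌊ n /2⌋ ≤ 1 + f
⌊/2⌋-fuel {n} le = ≤-trans (⌊n/2⌋≤⌈n/2⌉ n) (⌈/2⌉-fuel le)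

-- Position o ↦ term of an arrangement of {0, …, n-1}; any fuel f with n ≤ 1 + f suffices.
apFreePerm′ : (f n o : ℕ) → ℕ
apFreePerm′ zero    n o = 0
apFreePerm′ (suc f) n o with o <? ⌈ n /2⌉
... | yes _ = 2 * apFreePerm′ f ⌈ n /2⌉ o
... | no  _ = 1 + 2 * apFreePerm′ f ⌊ n /2⌋ (o ∸ ⌈ n /2⌉)

apFreePerm′-even : ∀ f {n o} → o < ⌈ n /2⌉ → apFreePerm′ (suc f) n o ≡ 2 * apFreePerm′ f ⌈ n /2⌉ o
apFreePerm′-even f {n} {o} lt with o <? ⌈ n /2⌉
... | yes _ = refl
... | no o≮ = contradiction lt o≮

apFreePerm′-odd : ∀ f {n o} → ¬ o < ⌈ n /2⌉ →
                  apFreePerm′ (suc f) n o ≡ 1 + 2 * apFreePerm′ f ⌊ n /2⌋ (o ∸ ⌈ n /2⌉)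
apFreePerm′-odd f {n} {o} o≮ with o <? ⌈ n /2⌉
... | yes lt = contradiction lt o≮
... | no _ = refl

o<n≤1⇒o≡0 : ∀ {o n} → n ≤ 1 → o < n → o ≡ 0
o<n≤1⇒o≡0 {zero}  _   _   = refl
o<n≤1⇒o≡0 {suc o} n≤1 o<n = contradiction (≤-trans o<n n≤1) λ { (s≤s ()) }

apFreePerm′-< : ∀ f {n o} → n ≤ 1 + f → o < n → apFreePerm′ f n o < n
apFreePerm′-< zero    _  o<n = ≤-trans z<s o<n
apFreePerm′-< (suc f) {n} {o} le o<n with o <? ⌈ n /2⌉
... | yes lt = <⌈/2⌉⇒2*< _ n (apFreePerm′-< f (⌈/2⌉-fuel le) lt)
... | no o≮  = <⌊/2⌋⇒1+2*< _ n (apFreePerm′-< f (⌊/2⌋-fuel le) (∸⌈/2⌉-< o≮ o<n))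

apFreePerm′-injective : ∀ f {n o o′} → n ≤ 1 + f → o < n → o′ < n →
                        apFreePerm′ f n o ≡ apFreePerm′ f n o′ → o ≡ o′
apFreePerm′-injective zero le o<n o′<n _ = trans (o<n≤1⇒o≡0 le o<n) (sym (o<n≤1⇒o≡0 le o′<n))
apFreePerm′-injective (suc f) {n} {o} {o′} le o<n o′<n eq with o <? ⌈ n /2⌉ | o′ <? ⌈ n /2⌉
... | yes lt | yes lt′ =
  apFreePerm′-injective f (⌈/2⌉-fuel le) lt lt′
    (*-cancelˡ-≡ (apFreePerm′ f ⌈ n /2⌉ o) (apFreePerm′ f ⌈ n /2⌉ o′) 2 eq)
... | yes _  | no _   =
  contradiction eq (even≢odd (apFreePerm′ f ⌈ n /2⌉ o) (apFreePerm′ f ⌊ n /2⌋ (o′ ∸ ⌈ n /2⌉)))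
... | no _   | yes _  =
  contradiction (sym eq) (even≢odd (apFreePerm′ f ⌈ n /2⌉ o′) (apFreePerm′ f ⌊ n /2⌋ (o ∸ ⌈ n /2⌉)))
... | no o≮  | no o′≮ = begin
  o                     ≡⟨ m∸n+n≡m (≮⇒≥ o≮) ⟨
  o ∸ ⌈ n /2⌉ + ⌈ n /2⌉  ≡⟨ cong (_+ ⌈ n /2⌉) halves ⟩
  o′ ∸ ⌈ n /2⌉ + ⌈ n /2⌉ ≡⟨ m∸n+n≡m (≮⇒≥ o′≮) ⟩
  o′                    ∎
  where
  open ≡-Reasoning
  halves : o ∸ ⌈ n /2⌉ ≡ o′ ∸ ⌈ n /2⌉
  halves = apFreePerm′-injective f (⌊/2⌋-fuel le) (∸⌈/2⌉-< o≮ o<n) (∸⌈/2⌉-< o′≮ o′<n)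
             (*-cancelˡ-≡ (apFreePerm′ f ⌊ n /2⌋ (o ∸ ⌈ n /2⌉))
                          (apFreePerm′ f ⌊ n /2⌋ (o′ ∸ ⌈ n /2⌉)) 2 (suc-injective eq))

apFreePerm′-surjective : ∀ f {n v} → n ≤ 1 + f → v < n → ∃ λ o → o < n × apFreePerm′ f n o ≡ v
apFreePerm′-surjective zero le v<n = 0 , ≤-trans z<s v<n , sym (o<n≤1⇒o≡0 le v<n)
apFreePerm′-surjective (suc f) {n} {v} le v<n with even-or-odd v
... | w , inj₁ refl with apFreePerm′-surjective f (⌈/2⌉-fuel le) (2*<⇒<⌈/2⌉ w n v<n)
...   | o , o<⌈n/2⌉ , eq =
  o , <-≤-trans o<⌈n/2⌉ (⌈n/2⌉≤n n) , trans (apFreePerm′-even f o<⌈n/2⌉) (cong (2 *_) eq)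
apFreePerm′-surjective (suc f) {n} {v} le v<n | w , inj₂ refl
  with apFreePerm′-surjective f (⌊/2⌋-fuel le) (1+2*<⇒<⌊/2⌋ w n v<n)
... | o , o<⌊n/2⌋ , eq = ⌈ n /2⌉ + o , in-range , value
  where
  open ≡-Reasoning
  in-range : ⌈ n /2⌉ + o < n
  in-range = subst (⌈ n /2⌉ + o <_) (trans (+-comm ⌈ n /2⌉ ⌊ n /2⌋) (⌊n/2⌋+⌈n/2⌉≡n n))
                   (+-monoʳ-< ⌈ n /2⌉ o<⌊n/2⌋)
  value : apFreePerm′ (suc f) n (⌈ n /2⌉ + o) ≡ 1 + 2 * w
  value = begin
    apFreePerm′ (suc f) n (⌈ n /2⌉ + o)                  ≡⟨ apFreePerm′-odd f (m+n≮m _ o) ⟩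
    1 + 2 * apFreePerm′ f ⌊ n /2⌋ (⌈ n /2⌉ + o ∸ ⌈ n /2⌉) ≡⟨ cong (λ o′ → 1 + 2 * apFreePerm′ f ⌊ n /2⌋ o′)
                                                                 (m+n∸m≡n ⌈ n /2⌉ o) ⟩
    1 + 2 * apFreePerm′ f ⌊ n /2⌋ o                      ≡⟨ cong (λ w′ → 1 + 2 * w′) eq ⟩
    1 + 2 * w                                            ∎

apFreePerm′-¬AP₃ : ∀ f {n o₁ o₂ o₃} → n ≤ 1 + f → o₁ < o₂ → o₂ < o₃ → o₃ < n →
                   ¬ AP₃ (apFreePerm′ f n o₁) (apFreePerm′ f n o₂) (apFreePerm′ f n o₃)
apFreePerm′-¬AP₃ zero le _ o₂<o₃ o₃<n _ = contradiction (o<n≤1⇒o≡0 le o₃<n) (m<n⇒n≢0 o₂<o₃)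
apFreePerm′-¬AP₃ (suc f) {n} {o₁} {o₂} {o₃} le o₁<o₂ o₂<o₃ o₃<n ap
  with o₁ <? ⌈ n /2⌉ | o₂ <? ⌈ n /2⌉ | o₃ <? ⌈ n /2⌉
... | yes _  | yes _  | yes l₃ =
  apFreePerm′-¬AP₃ f (⌈/2⌉-fuel le) o₁<o₂ o₂<o₃ l₃
    (AP₃-cancel-2* {evens o₁} {evens o₂} {evens o₃} ap)
  where
  evens : ℕ → ℕ
  evens = apFreePerm′ f ⌈ n /2⌉
... | yes _  | yes _  | no _   =
  ¬AP₃-even-odd (apFreePerm′ f ⌈ n /2⌉ o₁) (2 * apFreePerm′ f ⌈ n /2⌉ o₂)
    (apFreePerm′ f ⌊ n /2⌋ (o₃ ∸ ⌈ n /2⌉)) ap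
... | yes _  | no _   | no _   =
  ¬AP₃-even-odd (apFreePerm′ f ⌈ n /2⌉ o₁) (1 + 2 * apFreePerm′ f ⌊ n /2⌋ (o₂ ∸ ⌈ n /2⌉))
    (apFreePerm′ f ⌊ n /2⌋ (o₃ ∸ ⌈ n /2⌉)) ap
... | yes _  | no o₂≮ | yes l₃ = o₂≮ (<-trans o₂<o₃ l₃)
... | no o₁≮ | yes l₂ | _      = o₁≮ (<-trans o₁<o₂ l₂)
... | no o₁≮ | no _   | yes l₃ = o₁≮ (<-trans (<-trans o₁<o₂ o₂<o₃) l₃)
... | no o₁≮ | no o₂≮ | no o₃≮ =
  apFreePerm′-¬AP₃ f (⌊/2⌋-fuel le)
    (∸-monoˡ-< o₁<o₂ (≮⇒≥ o₁≮)) (∸-monoˡ-< o₂<o₃ (≮⇒≥ o₂≮)) (∸⌈/2⌉-< o₃≮ o₃<n)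
    (AP₃-cancel-2* {odds o₁} {odds o₂} {odds o₃} (AP₃-cancelˡ 1 ap))
  where
  odds : ℕ → ℕ
  odds o = apFreePerm′ f ⌊ n /2⌋ (o ∸ ⌈ n /2⌉)

apFreePerm : ℕ → ℕ → ℕ
apFreePerm n = apFreePerm′ n n

count-member : ∀ S m → S (suc m) ≡ true → count S (suc m) ≡ suc (count S m)
count-member S m Sm rewrite Sm = +-comm (count S m) 1

count-mono : ∀ S {m m′} → m ≤ m′ → count S m ≤ count S m′
count-mono S m≤m′ = go (≤⇒≤′ m≤m′)
  where
  go : ∀ {m m′} → m ≤′ m′ → count S m ≤ count S m′
  go ≤′-refl       = ≤-refl
  go (≤′-step m≤m′) = ≤-trans (go m≤m′) (m≤m+n _ _)

count-run : ∀ S a r → (∀ o → o < r → S (suc (a + o)) ≡ true) → count S a + r ≤ count S (a + r)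
count-run S a zero    _   = ≤-reflexive (trans (+-identityʳ _) (cong (count S) (sym (+-identityʳ a))))
count-run S a (suc r) run = begin
  count S a + suc r        ≡⟨ +-suc (count S a) r ⟩
  suc (count S a + r)      ≤⟨ s≤s (count-run S a r (λ o o<r → run o (m<n⇒m<1+n o<r))) ⟩
  suc (count S (a + r))    ≡⟨ count-member S (a + r) (run r ≤-refl) ⟨
  count S (suc (a + r))    ≡⟨ cong (count S) (+-suc a r) ⟨
  count S (a + suc r)      ∎
  where open ≤-Reasoning

prefixSum : (ℕ → ℕ) → ℕ → ℕ
prefixSum n zero    = 0
prefixSum n (suc j) = prefixSum n j + n j

affine-step : ∀ {a b d r} K c → 0 < K → a ≤ K * b + c → b + r ≤ d → a + r ≤ K * d + c
affine-step {a} {b} {d} {r} K c K>0 a≤ b+r≤d = begin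
  a + r              ≤⟨ +-mono-≤ a≤ (m≤n*m r K {{ℕ.>-nonZero K>0}}) ⟩
  K * b + c + K * r  ≡⟨ regroup K b c r ⟩
  K * (b + r) + c    ≤⟨ +-monoˡ-≤ c (*-monoʳ-≤ K b+r≤d) ⟩
  K * d + c          ∎
  where
  open ≤-Reasoning
  regroup : ∀ K b c r → K * b + c + K * r ≡ K * (b + r) + c
  regroup = solve-∀

module BlockUnion (A n : ℕ → ℕ) (n>0 : ∀ j → 0 < n j)
                  (separated : ∀ j → 2 * (A j + n j) ≤ A (suc j)) where

  InBlock : ℕ → ℕ → Set
  InBlock j x = A j < x × x ≤ A j + n j

  blockEnd<A : ∀ j → A j + n j < A (suc j)
  blockEnd<A j = <-≤-trans blockEnd<2*blockEnd (separated j)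
    where
    blockEnd<2*blockEnd : A j + n j < 2 * (A j + n j)
    blockEnd<2*blockEnd = subst (A j + n j <_) (*-comm (A j + n j) 2)
      (m<m*n (A j + n j) 2 {{ℕ.>-nonZero (≤-trans (n>0 j) (m≤n+m (n j) (A j)))}} ≤-refl)

  blockEnd-mono : ∀ {j j′} → j ≤ j′ → A j + n j ≤ A j′ + n j′
  blockEnd-mono j≤j′ = go (≤⇒≤′ j≤j′)
    where
    go : ∀ {j j′} → j ≤′ j′ → A j + n j ≤ A j′ + n j′
    go ≤′-refl              = ≤-refl
    go (≤′-step {j′} j≤′j′) =
      ≤-trans (go j≤′j′) (≤-trans (<⇒≤ (blockEnd<A j′)) (m≤m+n (A (suc j′)) (n (suc j′))))

  separated-< : ∀ {j j′} → j < j′ → 2 * (A j + n j) ≤ A j′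
  separated-< {j} {suc j′} (s≤s j≤j′) = ≤-trans (*-monoʳ-≤ 2 (blockEnd-mono j≤j′)) (separated j′)

  j≤A : ∀ j → j ≤ A j
  j≤A zero    = z≤n
  j≤A (suc j) = ≤-trans (s≤s (≤-trans (j≤A j) (m≤m+n (A j) (n j)))) (blockEnd<A j)

  j<blockEnd : ∀ j → j < A j + n j
  j<blockEnd j = ≤-<-trans (j≤A j) (m<m+n (A j) (n>0 j))

  inBlock-precedes : ∀ {j j′ x y} → j < j′ → InBlock j x → InBlock j′ y → 2 * x < y
  inBlock-precedes j<j′ (_ , x≤) (A′<y , _) =
    ≤-<-trans (*-monoʳ-≤ 2 x≤) (≤-<-trans (separated-< j<j′) A′<y)

  inBlock? : ∀ j x → Dec (InBlock j x)
  inBlock? j x = A j <? x ×-dec x ≤? A j + n j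

  inSomeBlock? : ∀ x → Dec (∃ λ (j : Fin (suc x)) → InBlock (toℕ j) x)
  inSomeBlock? x = any? λ j → inBlock? (toℕ j) x

  -- Only blocks j ≤ x are searched; no later block can contain x since j ≤ A j.
  S : NatSet
  S x = does (inSomeBlock? x)

  S-positive : PositiveSet S
  S-positive = dec-false (inSomeBlock? 0) λ (_ , A<0 , _) → n≮0 A<0

  S-complete : ∀ {j x} → InBlock j x → S x ≡ true
  S-complete {j} {x} x∈ =
    dec-true (inSomeBlock? x) (fromℕ< j<1+x , subst (λ i → InBlock i x) (sym (toℕ-fromℕ< j<1+x)) x∈)
    where
    j<1+x : j < suc x
    j<1+x = s≤s (≤-trans (j≤A j) (<⇒≤ (proj₁ x∈)))

  S-sound : ∀ x → S x ≡ true → ∃ λ j → InBlock j x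
  S-sound x Sx with invert (subst (Reflects _) Sx (proof (inSomeBlock? x)))
  ... | j , x∈ = toℕ j , x∈

  inBlock-< : ∀ {j j′ x y} → j < j′ → InBlock j x → InBlock j′ y → x < y
  inBlock-< {x = x} j<j′ x∈ y∈ = ≤-<-trans (m≤n*m x 2) (inBlock-precedes j<j′ x∈ y∈)

  Position : Set
  Position = ℕ × ℕ

  Valid : Position → Set
  Valid (j , o) = o < n j

  _≺_ : Position → Position → Set
  _≺_ = ×-Lex _≡_ _<_ _<_

  ≺-trans : ∀ {p q r} → p ≺ q → q ≺ r → p ≺ r
  ≺-trans = ×-transitive {_≈₁_ = _≡_} {_<₁_ = _<_} {_<₂_ = _<_}
                         isEquivalence (resp₂ _<_) <-trans <-trans

  ≺-irrefl : ∀ {p} → ¬ p ≺ p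
  ≺-irrefl (inj₁ j<j)       = <-irrefl refl j<j
  ≺-irrefl (inj₂ (_ , o<o)) = <-irrefl refl o<o

  next : Position → Position
  next (j , o) with suc o <? n j
  ... | yes _ = j , suc o
  ... | no  _ = suc j , 0

  next-valid : ∀ p → Valid (next p)
  next-valid (j , o) with suc o <? n j
  ... | yes 1+o<n = 1+o<n
  ... | no  _     = n>0 (suc j)

  next-≻ : ∀ p → p ≺ next p
  next-≻ (j , o) with suc o <? n j
  ... | yes _ = inj₂ (refl , n<1+n o)
  ... | no  _ = inj₁ (n<1+n j)

  next-inner : ∀ {j o} → suc o < n j → next (j , o) ≡ (j , suc o)
  next-inner {j} {o} 1+o<n with suc o <? n j
  ... | yes _    = refl
  ... | no 1+o≮n = contradiction 1+o<n 1+o≮n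

  next-last : ∀ {j o} → suc o ≡ n j → next (j , o) ≡ (suc j , 0)
  next-last {j} {o} 1+o≡n with suc o <? n j
  ... | yes 1+o<n = contradiction 1+o≡n (<⇒≢ 1+o<n)
  ... | no _      = refl

  position : ℕ → Position
  position zero    = 0 , 0
  position (suc i) = next (position i)

  position-valid : ∀ i → Valid (position i)
  position-valid zero    = n>0 0
  position-valid (suc i) = next-valid (position i)

  position-≺ : ∀ {i i′} → i < i′ → position i ≺ position i′
  position-≺ i<i′ = go (≤⇒≤′ i<i′)
    where
    go : ∀ {i i′} → suc i ≤′ i′ → position i ≺ position i′
    go ≤′-refl      = next-≻ _
    go (≤′-step lt) = ≺-trans (go lt) (next-≻ _)

  position-injective : ∀ {i i′} → position i ≡ position i′ → i ≡ i′
  position-injective {i} {i′} eq with <-cmp i i′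
  ... | tri< i<i′ _ _ = contradiction (subst (_≺ position i′) eq (position-≺ i<i′)) ≺-irrefl
  ... | tri≈ _ i≡i′ _ = i≡i′
  ... | tri> _ _ i′<i = contradiction (subst (position i′ ≺_) eq (position-≺ i′<i)) ≺-irrefl

  position-prefixSum : ∀ j o → o < n j → position (prefixSum n j + o) ≡ (j , o)
  position-prefixSum zero    zero    _     = refl
  position-prefixSum (suc j) zero    _     = begin
    position (prefixSum n j + n j + 0)  ≡⟨ cong position (trans (+-identityʳ _)
                                                               (cong (_+_ (prefixSum n j)) (sym m+1≡n))) ⟩
    position (prefixSum n j + suc m)    ≡⟨ cong position (+-suc (prefixSum n j) m) ⟩
    next (position (prefixSum n j + m)) ≡⟨ cong next (position-prefixSum j m (subst (m <_) m+1≡n ≤-refl)) ⟩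
    next (j , m)                        ≡⟨ next-last m+1≡n ⟩
    (suc j , 0)                         ∎
    where
    open ≡-Reasoning
    m : ℕ
    m = ℕ.pred (n j)
    m+1≡n : suc m ≡ n j
    m+1≡n = suc-pred (n j) {{ℕ.>-nonZero (n>0 j)}}
  position-prefixSum j       (suc o) 1+o<n = begin
    position (prefixSum n j + suc o)    ≡⟨ cong position (+-suc (prefixSum n j) o) ⟩
    next (position (prefixSum n j + o)) ≡⟨ cong next (position-prefixSum j o (<-trans (n<1+n o) 1+o<n)) ⟩
    next (j , o)                        ≡⟨ next-inner 1+o<n ⟩
    (j , suc o)                         ∎
    where open ≡-Reasoning

  term : Position → ℕ
  term (j , o) = suc (A j + apFreePerm (n j) o)

  term-inBlock : ∀ {j o} → o < n j → InBlock j (term (j , o))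
  term-inBlock {j} o<n = s≤s (m≤m+n (A j) _) , +-monoʳ-< (A j) (apFreePerm′-< (n j) (n≤1+n _) o<n)

  term-injective : ∀ {p q} → Valid p → Valid q → term p ≡ term q → p ≡ q
  term-injective {j , o} {j′ , o′} v v′ eq with <-cmp j j′
  ... | tri< j<j′ _ _ = contradiction eq (<⇒≢ (inBlock-< j<j′ (term-inBlock v) (term-inBlock v′)))
  ... | tri> _ _ j′<j = contradiction (sym eq) (<⇒≢ (inBlock-< j′<j (term-inBlock v′) (term-inBlock v)))
  ... | tri≈ _ refl _ = cong (j ,_)
    (apFreePerm′-injective (n j) (n≤1+n _) v v′ (+-cancelˡ-≡ (A j) _ _ (suc-injective eq)))

  s : ℕ → ℕ
  s i = term (position i)

  s-injective : Injective _≡_ _≡_ s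
  s-injective {i} {i′} eq = position-injective (term-injective (position-valid i) (position-valid i′) eq)

  s-sound : ∀ x → (∃ λ i → s i ≡ x) → S x ≡ true
  s-sound x (i , refl) = S-complete (term-inBlock (position-valid i))

  s-complete : ∀ x → S x ≡ true → ∃ λ i → s i ≡ x
  s-complete x Sx with S-sound x Sx
  ... | j , A<x , x≤end with apFreePerm′-surjective (n j) (n≤1+n _) offset<n
    where
    offset<n : x ∸ suc (A j) < n j
    offset<n = subst (x ∸ suc (A j) <_) (m+n∸m≡n (A j) (n j)) (∸-monoˡ-< (s≤s x≤end) A<x)
  ...   | o , o<n , perm≡ = prefixSum n j + o , (begin
    s (prefixSum n j + o)           ≡⟨ cong term (position-prefixSum j o o<n) ⟩
    suc (A j + apFreePerm (n j) o)  ≡⟨ cong (λ v → suc (A j + v)) perm≡ ⟩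
    suc (A j) + (x ∸ suc (A j))     ≡⟨ m+[n∸m]≡n A<x ⟩
    x                               ∎)
    where open ≡-Reasoning

  ¬AP₃-across : ∀ {j j′ x y z} → j < j′ → InBlock j y → InBlock j′ z → ¬ AP₃ x y z
  ¬AP₃-across {x = x} {z = z} j<j′ y∈ z∈ ap =
    <⇒≱ (inBlock-precedes j<j′ y∈ z∈) (≤-trans (m≤n+m z x) (≤-reflexive ap))

  ¬AP₃-inside : ∀ {j o₁ o₂ o₃} → o₁ < o₂ → o₂ < o₃ → o₃ < n j →
                ¬ AP₃ (term (j , o₁)) (term (j , o₂)) (term (j , o₃))
  ¬AP₃-inside {j} o₁<o₂ o₂<o₃ o₃<n ap =
    apFreePerm′-¬AP₃ (n j) (n≤1+n _) o₁<o₂ o₂<o₃ o₃<n (AP₃-cancelˡ (suc (A j)) ap)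

  ¬AP₃×AP₃ : ∀ {p₁ p₂ p₃ p₄} → p₂ ≺ p₃ → p₃ ≺ p₄ → Valid p₂ → Valid p₃ → Valid p₄ →
             ¬ (AP₃ (term p₁) (term p₂) (term p₃) × AP₃ (term p₂) (term p₃) (term p₄))
  ¬AP₃×AP₃ {p₂ = p₂@(_ , _)} {_ , _} {_ , _} _ (inj₁ j₃<j₄) _ v₃ v₄ (_ , ap₂₃₄) =
    ¬AP₃-across {x = term p₂} j₃<j₄ (term-inBlock v₃) (term-inBlock v₄) ap₂₃₄
  ¬AP₃×AP₃ {p₁} {_ , _} {_ , _} {_ , _} (inj₁ j₂<j₃) (inj₂ (refl , _)) v₂ v₃ _ (ap₁₂₃ , _) =
    ¬AP₃-across {x = term p₁} j₂<j₃ (term-inBlock v₂) (term-inBlock v₃) ap₁₂₃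
  ¬AP₃×AP₃ {p₂ = _ , _} {_ , _} {_ , _} (inj₂ (refl , o₂<o₃)) (inj₂ (refl , o₃<o₄)) _ _ v₄
           (_ , ap₂₃₄) =
    ¬AP₃-inside o₂<o₃ o₃<o₄ v₄ ap₂₃₄

  s-4APfree : NoAPSeq 4 s
  s-4APfree idx increasing ap =
    ¬AP₃×AP₃ {position (idx 0F)} (ordered (s<s z<s)) (ordered (s<s (s<s z<s)))
      (valid 1F) (valid 2F) (valid 3F)
      (IsNontrivialAP⇒AP₃ (s ∘ idx) ap ,
       IsNontrivialAP⇒AP₃ (s ∘ idx ∘ Fin.suc) (IsNontrivialAP-tail (s ∘ idx) ap))
    where
    ordered : ∀ {a b} → a Fin.< b → position (idx a) ≺ position (idx b)
    ordered a<b = position-≺ (increasing _ _ a<b)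
    valid : ∀ a → Valid (position (idx a))
    valid a = position-valid (idx a)

  S-4free : Free 4 S
  S-4free = inj₂ (s , s-injective , (λ x → s-complete x , s-sound x) , s-4APfree)

  module ThreeAPFree (gap : ∀ j → A j + n j + n (suc j) ≤ A (suc j)) where

    ¬AP₃-entering : ∀ {j j′ x y z} → j < j′ →
                    InBlock j x → InBlock j′ y → InBlock j′ z → ¬ AP₃ x y z
    ¬AP₃-entering {j} {suc j′} {x} {y} {z} (s≤s j≤j′) (_ , x≤) (A<y , _) (_ , z≤) ap =
      <⇒≢ x+z<2y ap
      where
      E : ℕ
      E = A j′ + n j′
      x+z<2y : x + z < 2 * y
      x+z<2y = begin-strict
        x + z                           ≤⟨ +-mono-≤ (≤-trans x≤ (blockEnd-mono j≤j′)) z≤ ⟩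
        E + (A (suc j′) + n (suc j′))   ≡⟨ regroup E (A (suc j′)) (n (suc j′)) ⟩
        (E + n (suc j′)) + A (suc j′)   ≤⟨ +-monoˡ-≤ (A (suc j′)) (gap j′) ⟩
        A (suc j′) + A (suc j′)         <⟨ +-mono-< A<y A<y ⟩
        y + y                           ≡⟨ cong (_+_ y) (+-identityʳ y) ⟨
        2 * y                           ∎
        where
        open ≤-Reasoning
        regroup : ∀ e a m → e + (a + m) ≡ (e + m) + a
        regroup = solve-∀

    ¬AP₃-ordered : ∀ {p₁ p₂ p₃} → p₁ ≺ p₂ → p₂ ≺ p₃ → Valid p₁ → Valid p₂ → Valid p₃ →
                   ¬ AP₃ (term p₁) (term p₂) (term p₃)
    ¬AP₃-ordered {p₁@(_ , _)} {_ , _} {_ , _} _ (inj₁ j₂<j₃) _ v₂ v₃ =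
      ¬AP₃-across {x = term p₁} j₂<j₃ (term-inBlock v₂) (term-inBlock v₃)
    ¬AP₃-ordered {_ , _} {_ , _} {_ , _} (inj₁ j₁<j₂) (inj₂ (refl , _)) v₁ v₂ v₃ =
      ¬AP₃-entering j₁<j₂ (term-inBlock v₁) (term-inBlock v₂) (term-inBlock v₃)
    ¬AP₃-ordered {_ , _} {_ , _} {_ , _} (inj₂ (refl , o₁<o₂)) (inj₂ (refl , o₂<o₃)) _ _ v₃ =
      ¬AP₃-inside o₁<o₂ o₂<o₃ v₃

    s-3APfree : NoAPSeq 3 s
    s-3APfree idx increasing ap = ¬AP₃-ordered (ordered z<s) (ordered (s<s z<s))
      (valid 0F) (valid 1F) (valid 2F) (IsNontrivialAP⇒AP₃ (s ∘ idx) ap)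
      where
      ordered : ∀ {a b} → a Fin.< b → position (idx a) ≺ position (idx b)
      ordered a<b = position-≺ (increasing _ _ a<b)
      valid : ∀ a → Valid (position (idx a))
      valid a = position-valid (idx a)

    S-3free : Free 3 S
    S-3free = inj₂ (s , s-injective , (λ x → s-complete x , s-sound x) , s-3APfree)

  block-run : ∀ j r → r ≤ n j → count S (A j) + r ≤ count S (A j + r)
  block-run j r r≤n = count-run S (A j) r λ o o<r →
    S-complete (s≤s (m≤m+n (A j) o) ,
                subst (_≤ A j + n j) (+-suc (A j) o) (+-monoʳ-≤ (A j) (<-≤-trans o<r r≤n)))

  n≤count-blockEnd : ∀ j → n j ≤ count S (A j + n j)
  n≤count-blockEnd j = ≤-trans (m≤n+m (n j) _) (block-run j (n j) ≤-refl)

  prefixSum≤count-blockEnd : ∀ j → prefixSum n (suc j) ≤ count S (A j + n j)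
  prefixSum≤count-blockEnd zero    = n≤count-blockEnd 0
  prefixSum≤count-blockEnd (suc j) = begin
    prefixSum n (suc j) + n (suc j)  ≤⟨ +-monoˡ-≤ (n (suc j)) (≤-trans (prefixSum≤count-blockEnd j)
                                                                  (count-mono S (<⇒≤ (blockEnd<A j)))) ⟩
    count S (A (suc j)) + n (suc j)  ≤⟨ block-run (suc j) (n (suc j)) ≤-refl ⟩
    count S (A (suc j) + n (suc j))  ∎
    where open ≤-Reasoning

  count-linear : ∀ K c → 0 < K → A 0 ≤ c → (∀ j → A (suc j) ≤ K * prefixSum n (suc j) + c) →
                 ∀ m → m ≤ K * count S m + c
  count-linear K c K>0 A₀≤c A≤ m = upTo-blockEnd m (<⇒≤ (j<blockEnd m))
    where
    Bounded : ℕ → Set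
    Bounded m = m ≤ K * count S m + c

    mutual
      upTo-A : ∀ j {m} → m ≤ A j → Bounded m
      upTo-A zero    m≤A = ≤-trans m≤A (≤-trans A₀≤c (m≤n+m c _))
      upTo-A (suc j) {m} m≤A with m ≤? A j + n j
      ... | yes m≤end = upTo-blockEnd j m≤end
      ... | no  m≰end = begin
        m                                ≤⟨ m≤A ⟩
        A (suc j)                        ≤⟨ A≤ j ⟩
        K * prefixSum n (suc j) + c      ≤⟨ +-monoˡ-≤ c (*-monoʳ-≤ K (≤-trans (prefixSum≤count-blockEnd j)
                                                                     (count-mono S (<⇒≤ (≰⇒> m≰end))))) ⟩
        K * count S m + c                ∎
        where open ≤-Reasoning

      upTo-blockEnd : ∀ j {m} → m ≤ A j + n j → Bounded m
      upTo-blockEnd j {m} m≤end with m ≤? A j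
      ... | yes m≤A = upTo-A j m≤A
      ... | no  m≰A = subst Bounded (m+[n∸m]≡n A≤m)
                        (affine-step K c K>0 (upTo-A j ≤-refl) (block-run j (m ∸ A j) r≤n))
        where
        A≤m : A j ≤ m
        A≤m = <⇒≤ (≰⇒> m≰A)
        r≤n : m ∸ A j ≤ n j
        r≤n = subst (m ∸ A j ≤_) (m+n∸m≡n (A j) (n j)) (∸-monoˡ-≤ (A j) m≤end)

module Powers-of-3 where

  separated : ∀ j → 2 * (2 * 3 ^ j + 3 ^ j) ≤ 2 * 3 ^ suc j
  separated j = ≤-reflexive (2[2x+x]≡2[3x] (3 ^ j))
    where
    2[2x+x]≡2[3x] : ∀ x → 2 * (2 * x + x) ≡ 2 * (3 * x)
    2[2x+x]≡2[3x] = solve-∀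

  open BlockUnion (λ j → 2 * 3 ^ j) (3 ^_) (m^n>0 3) separated public

  gap : ∀ j → 2 * 3 ^ j + 3 ^ j + 3 ^ suc j ≤ 2 * 3 ^ suc j
  gap j = ≤-reflexive (2x+x+3x≡2[3x] (3 ^ j))
    where
    2x+x+3x≡2[3x] : ∀ x → 2 * x + x + 3 * x ≡ 2 * (3 * x)
    2x+x+3x≡2[3x] = solve-∀

  2*prefixSum+1 : ∀ j → 2 * prefixSum (3 ^_) (suc j) + 1 ≡ 3 ^ suc j
  2*prefixSum+1 zero    = refl
  2*prefixSum+1 (suc j) = begin
    2 * (P + y) + 1        ≡⟨ 2[P+y]+1≡2P+1+2y P y ⟩
    (2 * P + 1) + 2 * y    ≡⟨ cong (_+ 2 * y) (2*prefixSum+1 j) ⟩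
    y + 2 * y              ≡⟨ y+2y≡3y y ⟩
    3 * y                  ∎
    where
    open ≡-Reasoning
    P y : ℕ
    P = prefixSum (3 ^_) (suc j)
    y = 3 ^ suc j
    2[P+y]+1≡2P+1+2y : ∀ P y → 2 * (P + y) + 1 ≡ (2 * P + 1) + 2 * y
    2[P+y]+1≡2P+1+2y = solve-∀
    y+2y≡3y : ∀ y → y + 2 * y ≡ 3 * y
    y+2y≡3y = solve-∀

  blockEnd≤ : ∀ j → 2 * 3 ^ j + 3 ^ j ≤ 2 * count S (2 * 3 ^ j + 3 ^ j) + 1
  blockEnd≤ j = begin
    2 * 3 ^ j + 3 ^ j                        ≡⟨ 2x+x≡3x (3 ^ j) ⟩
    3 ^ suc j                                ≡⟨ 2*prefixSum+1 j ⟨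
    2 * prefixSum (3 ^_) (suc j) + 1         ≤⟨ +-monoˡ-≤ 1 (*-monoʳ-≤ 2 (prefixSum≤count-blockEnd j)) ⟩
    2 * count S (2 * 3 ^ j + 3 ^ j) + 1      ∎
    where
    open ≤-Reasoning
    2x+x≡3x : ∀ x → 2 * x + x ≡ 3 * x
    2x+x≡3x = solve-∀

  A≤4*prefixSum+2 : ∀ j → 2 * 3 ^ suc j ≤ 4 * prefixSum (3 ^_) (suc j) + 2
  A≤4*prefixSum+2 j =
    ≤-reflexive (trans (cong (2 *_) (sym (2*prefixSum+1 j))) (2[2P+1]≡4P+2 (prefixSum (3 ^_) (suc j))))
    where
    2[2P+1]≡4P+2 : ∀ P → 2 * (2 * P + 1) ≡ 4 * P + 2
    2[2P+1]≡4P+2 = solve-∀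

module Powers-of-4 where

  n>0 : ∀ j → 0 < 2 * 4 ^ j
  n>0 j = ≤-trans (m^n>0 4 j) (m≤n*m (4 ^ j) 2)

  separated : ∀ j → 2 * (2 * 4 ^ j + 2 * 4 ^ j) ≤ 2 * 4 ^ suc j
  separated j = ≤-reflexive (2[2x+2x]≡2[4x] (4 ^ j))
    where
    2[2x+2x]≡2[4x] : ∀ x → 2 * (2 * x + 2 * x) ≡ 2 * (4 * x)
    2[2x+2x]≡2[4x] = solve-∀

  open BlockUnion (λ j → 2 * 4 ^ j) (λ j → 2 * 4 ^ j) n>0 separated public

  3*prefixSum+2 : ∀ j → 3 * prefixSum (λ j → 2 * 4 ^ j) (suc j) + 2 ≡ 2 * 4 ^ suc j
  3*prefixSum+2 zero    = refl
  3*prefixSum+2 (suc j) = begin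
    3 * (P + 2 * z) + 2        ≡⟨ 3[P+2z]+2≡3P+2+6z P z ⟩
    (3 * P + 2) + 6 * z        ≡⟨ cong (_+ 6 * z) (3*prefixSum+2 j) ⟩
    2 * z + 6 * z              ≡⟨ 2z+6z≡2[4z] z ⟩
    2 * (4 * z)                ∎
    where
    open ≡-Reasoning
    P z : ℕ
    P = prefixSum (λ j → 2 * 4 ^ j) (suc j)
    z = 4 ^ suc j
    3[P+2z]+2≡3P+2+6z : ∀ P z → 3 * (P + 2 * z) + 2 ≡ (3 * P + 2) + 6 * z
    3[P+2z]+2≡3P+2+6z = solve-∀
    2z+6z≡2[4z] : ∀ z → 2 * z + 6 * z ≡ 2 * (4 * z)
    2z+6z≡2[4z] = solve-∀

  A≤3*prefixSum+2 : ∀ j → 2 * 4 ^ suc j ≤ 3 * prefixSum (λ j → 2 * 4 ^ j) (suc j) + 2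
  A≤3*prefixSum+2 j = ≤-reflexive (sym (3*prefixSum+2 j))

module Powers-of-2t+2 (t : ℕ) (t>0 : 0 < t) where

  ρ : ℕ
  ρ = 2 * suc t

  n>0 : ∀ j → 0 < t * ρ ^ j
  n>0 j = ≤-trans (m^n>0 ρ j) (m≤n*m (ρ ^ j) t {{ℕ.>-nonZero t>0}})

  separated : ∀ j → 2 * (ρ ^ j + t * ρ ^ j) ≤ ρ ^ suc j
  separated j = ≤-reflexive (2[x+tx]≡2[1+t]x t (ρ ^ j))
    where
    2[x+tx]≡2[1+t]x : ∀ t x → 2 * (x + t * x) ≡ 2 * suc t * x
    2[x+tx]≡2[1+t]x = solve-∀

  open BlockUnion (ρ ^_) (λ j → t * ρ ^ j) n>0 separated public

  t*blockEnd≤ : ∀ j → t * (ρ ^ j + t * ρ ^ j) ≤ count S (ρ ^ j + t * ρ ^ j) * suc t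
  t*blockEnd≤ j = ≤-trans (≤-reflexive (t[x+tx]≡tx[1+t] t (ρ ^ j))) (*-monoˡ-≤ (suc t) (n≤count-blockEnd j))
    where
    t[x+tx]≡tx[1+t] : ∀ t x → t * (x + t * x) ≡ t * x * suc t
    t[x+tx]≡tx[1+t] = solve-∀

α₄≥1 : AlphaAtLeast 4 1ℚ
α₄≥1 ε 0<ε = S , S-positive , S-4free ,
  upperDensity-mono (1-ε≤t/1+t ε 0<ε) (upperDensity-frequent S t t λ M → _ , j<blockEnd M , t*blockEnd≤ M)
  where
  t : ℕ
  t = ↧ₙ ε
  open Powers-of-2t+2 t z<s

α₄≤1 : AlphaAtMost 4 1ℚ
α₄≤1 S _ _ = upperDensity≤1 S

α₃≥1/2 : AlphaAtLeast 3 (+ 1 / 2)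
α₃≥1/2 ε 0<ε = S , S-positive , ThreeAPFree.S-3free gap ,
  upperDensity-linear S 1 1 (s≤s z≤n) (λ M → _ , j<blockEnd M , blockEnd≤ M) ε 0<ε
  where open Powers-of-3

β₄≥1/3 : BetaAtLeast 4 (+ 1 / 3)
β₄≥1/3 ε 0<ε = S , S-positive , S-4free ,
  lowerDensity-linear S 2 2 (s≤s (s≤s z≤n)) (count-linear 3 2 z<s ≤-refl A≤3*prefixSum+2) ε 0<ε
  where open Powers-of-4

β₃≥1/4 : BetaAtLeast 3 (+ 1 / 4)
β₃≥1/4 ε 0<ε = S , S-positive , ThreeAPFree.S-3free gap ,
  lowerDensity-linear S 3 2 (s≤s (s≤s z≤n)) (count-linear 4 2 z<s ≤-refl A≤4*prefixSum+2) ε 0<ε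
  where open Powers-of-3

theorem3 : (AlphaAtLeast 4 1ℚ × AlphaAtMost 4 1ℚ)
           × AlphaAtLeast 3 (+ 1 / 2)
           × BetaAtLeast 4 (+ 1 / 3)
           × BetaAtLeast 3 (+ 1 / 4)
theorem3 = (α₄≥1 , α₄≤1) , α₃≥1/2 , β₄≥1/3 , β₃≥1/4
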